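{- Let $q>2$ be a prime power and $k$ a positive integer. Let $f$ be a permutation of $\mathbb{F}_q$, extended to a permutation of $\mathbb{P}^1(\mathbb{F}_q)=\mathbb{F}_q\cup\{\infty\}$ fixing $\infty$. Then in any representation $$f=\mu(x)\circ x^{q-2}\circ(x-a_k)\circ x^{q-2}\circ(x-a_{k-1})\circ\cdots\circ x^{q-2}\circ(x-a_1)$$ with $a_1,\dots,a_k\in\mathbb{F}_q$ and $\mu(x)\in\mathbb{F}_q(x)$ of degree one, $\mu(x)$ is a degree-one polynomial in $\mathbb{F}_q[x]$. Consequently, the set of all such representations of $f$ with $\mu(x)\in\mathbb{F}_q[x]$ of degree one is in bijection with the set of all representations of $f$ of the form $$f=\nu(x)\circ(b_1,\infty)\circ(b_2,\infty)\circ\cdots\circ(b_k,\infty)$$ with $b_1,\dots,b_k\in\mathbb{F}_q$ and $\nu(x)\in\mathbb{F}_q(x)$ of degree one.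
   Context: All maps are regarded as permutations of $\mathbb{P}^1(\mathbb{F}_q)$; $f\circ g$ means apply $g$ first. Degree-one rational functions act on $\mathbb{P}^1(\mathbb{F}_q)$ in the usual way. $x^{q-2}$ acts by $c\mapsto c^{q-2}$ on $\mathbb{F}_q$ (so $0\mapsto0$) and fixes $\infty$; $x-a$ fixes $\infty$. $(b,\infty)$ is the transposition swapping $b$ and $\infty$. A representation means a tuple $(\mu,a_1,\dots,a_k)$ (resp. $(\nu,b_1,\dots,b_k)$) for which the displayed identity holds. -}

module Defs where

open import Level using (0ℓ)
open import Data.Nat using (ℕ; zero; suc; _<_)
open import Data.List using (List; length)
open import Data.List.Membership.Propositional using (_∈_)
open import Data.List.Relation.Unary.Unique.Propositional using (Unique)
open import Data.Maybe using (Maybe; just; nothing)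
open import Data.Vec using (Vec; []; _∷_)
open import Data.Unit using (⊤)
open import Data.Empty using (⊥)
open import Data.Product using (Σ; _×_; _,_; proj₁; ∃)
open import Function using (_∘_; id)
open import Function.Definitions using (Bijective)
open import Relation.Nullary using (Dec; yes; no; ¬_)
open import Relation.Binary.PropositionalEquality using (_≡_; _≢_)
open import Algebra.Structures using (IsCommutativeRing)

record FiniteField : Set₁ where
  infixl 7 _*_
  infixl 6 _+_ _-_
  field
    Carrier : Set
    _≟_     : (x y : Carrier) → Dec (x ≡ y)
    _+_ _*_ : Carrier → Carrier → Carrier
    -_      : Carrier → Carrier
    0# 1#   : Carrier
    isCommutativeRing : IsCommutativeRing _≡_ _+_ _*_ -_ 0# 1#
    0≢1     : 0# ≢ 1#
    -- multiplicative inverse; its value at 0# is irrelevant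
    _⁻¹     : Carrier → Carrier
    inverseʳ : ∀ x → x ≢ 0# → x * (x ⁻¹) ≡ 1#
    elements : List Carrier
    complete : ∀ x → x ∈ elements
    unique   : Unique elements

  _-_ : Carrier → Carrier → Carrier
  x - y = x + (- y)

  size : ℕ
  size = length elements

  pow : Carrier → ℕ → Carrier
  pow x zero    = 1#
  pow x (suc n) = x * pow x n

module _ (F : FiniteField) where
  open FiniteField F

  -- P^1(F_q) = F_q ∪ {∞}, with ∞ = nothing
  P1 : Set
  P1 = Maybe Carrier

  ext : (Carrier → Carrier) → P1 → P1
  ext f (just x) = just (f x)
  ext f nothing  = nothing

  -- Elements of F_q(x) of the shape (a x + b) or (a x + b)/(x + d), i.e.
  -- every element of F_q(x) of degree at most one written in lowest terms
  -- with monic denominator (canonical form; no scalar ambiguity).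
  data Rat1 : Set where
    poly : (a b : Carrier) → Rat1
    frac : (a b d : Carrier) → Rat1

  DegreeOne : Rat1 → Set
  DegreeOne (poly a b)   = a ≢ 0#
  DegreeOne (frac a b d) = (a * d - b) ≢ 0#

  IsPolynomial : Rat1 → Set
  IsPolynomial (poly a b)   = ⊤
  IsPolynomial (frac a b d) = ⊥

  act : Rat1 → P1 → P1
  act (poly a b)   (just x) = just (a * x + b)
  act (poly a b)   nothing  = nothing
  act (frac a b d) (just x) with (x + d) ≟ 0#
  ... | yes _ = nothing
  ... | no  _ = just ((a * x + b) * ((x + d) ⁻¹))
  act (frac a b d) nothing  = just a

  powInv : P1 → P1
  powInv = ext (λ c → pow c (size Data.Nat.∸ 2))

  shift : Carrier → P1 → P1
  shift a = ext (λ c → c - a)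

  swap∞ : Carrier → P1 → P1
  swap∞ b nothing  = just b
  swap∞ b (just c) with c ≟ b
  ... | yes _ = nothing
  ... | no  _ = just c

  chainA : ∀ {k} → Vec Carrier k → P1 → P1
  chainA []       = id
  chainA (a ∷ as) = chainA as ∘ powInv ∘ shift a

  chainB : ∀ {k} → Vec Carrier k → P1 → P1
  chainB []       = id
  chainB (b ∷ bs) = swap∞ b ∘ chainB bs

  IsRepA : (f : Carrier → Carrier) (k : ℕ) → Rat1 × Vec Carrier k → Set
  IsRepA f k (μ , as) = DegreeOne μ × (∀ z → ext f z ≡ act μ (chainA as z))

  IsRepAPoly : (f : Carrier → Carrier) (k : ℕ) → Rat1 × Vec Carrier k → Set
  IsRepAPoly f k r = IsPolynomial (proj₁ r) × IsRepA f k r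

  IsRepB : (f : Carrier → Carrier) (k : ℕ) → Rat1 × Vec Carrier k → Set
  IsRepB f k (ν , bs) = DegreeOne ν × (∀ z → ext f z ≡ act ν (chainB bs z))

-- a bijection between the sets of tuples satisfying P and Q respectively
-- (a representation is the tuple; the proof component is irrelevant)
Bijection-Reps : {X Y : Set} (P : X → Set) (Q : Y → Set) → Set
Bijection-Reps {X} {Y} P Q =
  Σ (Σ X P → Σ Y Q) λ φ →
    (∀ (r s : Σ X P) → proj₁ (φ r) ≡ proj₁ (φ s) → proj₁ r ≡ proj₁ s)
    × (∀ (t : Σ Y Q) → Σ (Σ X P) λ r → proj₁ (φ r) ≡ proj₁ t)

{-# OPTIONS --safe #-}
-- Since x − a and x^{q−2} both fix ∞, so does the whole chain, which forces μ(∞) = ∞: μ is a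
-- polynomial. For the bijection let 1/x be the Möbius involution of P¹ exchanging 0 and ∞. On P¹,
-- x^{q−2} ∘ (x − a) = 1/(x − a) ∘ (a, ∞), and conjugating a transposition (b, ∞) by a permutation
-- fixing ∞ gives another transposition of the same kind. Pushing the Möbius factors to the left
-- rewrites x^{q−2} ∘ (x − a_k) ∘ ⋯ ∘ x^{q−2} ∘ (x − a_1) as M ∘ (b_1, ∞) ∘ ⋯ ∘ (b_k, ∞), where M is
-- a composite of the maps 1/(x − a_i) and b arises from a by an invertible triangular recursion.
-- Then (μ, a) ↦ (μ ∘ M, b) is the bijection: degree-one rational functions are closed under
-- composition with M and M⁻¹, and such a function is determined by its action on P¹.
module Submission where

open import Defs
open import Data.Nat using (ℕ; _≤_; _<_)
open import Data.Vec using (Vec)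
open import Data.Product using (_×_; _,_)
open import Function.Definitions using (Bijective)
open import Relation.Binary.PropositionalEquality using (_≡_)

open import Level using (0ℓ)
open import Data.Nat using (zero; suc; _∸_; s≤s)
import Data.Nat as ℕ
import Data.Nat.Properties as ℕ
open import Data.Integer using (ℤ; +[1+_]; -[1+_]; _⊖_; _◃_; sign; ∣_∣)
import Data.Integer as ℤ
import Data.Integer.Properties as ℤ
open import Data.Sign using (Sign)
import Data.Sign as Sign
open import Data.Empty using (⊥-elim)
open import Data.Unit using (tt)
open import Data.Maybe using (just; nothing)
open import Data.Maybe.Properties using (just-injective)
import Data.Maybe as Maybe
open import Data.List using (List; []; _∷_; foldr; filter; length)
import Data.List as List
open import Data.List.Membership.Propositional using (_∈_)
open import Data.List.Membership.Propositional.Properties using (∈-filter⁺; ∈-filter⁻; ∈-map⁺; ∈-map⁻)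
open import Data.List.Membership.Propositional.Properties.WithK using (unique∧set⇒bag)
open import Data.List.Relation.Unary.Any using (here; there)
import Data.List.Relation.Unary.All as All
open import Data.List.Relation.Unary.AllPairs using (_∷_)
open import Data.List.Relation.Unary.Unique.Propositional using (Unique)
import Data.List.Relation.Unary.Unique.Propositional.Properties as UniqueProperties
open import Data.List.Relation.Binary.Permutation.Propositional using (_↭_; ↭⇒↭ₛ)
open import Data.List.Relation.Binary.Permutation.Propositional.Properties using (↭-length)
import Data.List.Relation.Binary.Permutation.Setoid.Properties as PermutationSetoid
open import Data.List.Relation.Binary.BagAndSetEquality using (∼bag⇒↭)
open import Data.Vec using ([]; _∷_; map)
open import Data.Vec.Properties using (map-∘; map-cong; map-id)
open import Data.Product using (Σ; proj₁; proj₂)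
open import Function using (_∘_; id; mk⇔)
open import Relation.Nullary using (Dec; yes; no; ¬?)
open import Relation.Binary.Consequences using (dec⇒weaklyDec)
open import Relation.Binary.PropositionalEquality
  using (_≢_; refl; sym; trans; cong; cong₂; subst; setoid; module ≡-Reasoning)
open import Algebra.Bundles using (CommutativeRing)
open import Algebra.Structures using (IsCommutativeRing)
open import Algebra.Solver.Ring.AlmostCommutativeRing using (fromCommutativeRing; _-Raw-AlmostCommutative⟶_)
import Algebra.Solver.Ring as RingSolver
import Algebra.Properties.Ring as RingProperties
import Algebra.Properties.Group as GroupProperties
import Algebra.Properties.Semiring.Mult as SemiringMult
import Algebra.Properties.CommutativeSemigroup as CommutativeSemigroupProperties

-- The ring solver over an abstract ring needs coefficients whose equality is decided by
-- computation; the field's own _≟_ does not reduce, so the coefficients are taken in ℤ.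
module IntegerCoefficients
  {A : Set} {add mul : A → A → A} {neg : A → A} {0r 1r : A}
  (isCommutativeRing : IsCommutativeRing _≡_ add mul neg 0r 1r) where

  private
    commutativeRing : CommutativeRing 0ℓ 0ℓ
    commutativeRing = record { isCommutativeRing = isCommutativeRing }

    open CommutativeRing commutativeRing
      using (_+_; _*_; -_; 0#; 1#; ring; semiring; +-commutativeSemigroup; *-commutativeSemigroup;
             +-identityˡ; +-identityʳ; +-comm; -‿inverseʳ; *-identityˡ; *-identityʳ)
    open RingProperties ring using (-‿involutive; -0#≈0#; -‿distribˡ-*; -‿distribʳ-*; -‿+-comm)
    open SemiringMult semiring using (×-homo-+; ×1-homo-*) renaming (_×_ to _×ₙ_)
    open CommutativeSemigroupProperties +-commutativeSemigroup using () renaming (interchange to +-interchange)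
    open CommutativeSemigroupProperties *-commutativeSemigroup using () renaming (interchange to *-interchange)
    open ≡-Reasoning

    ⟦_⟧ : ℤ → A
    ⟦ ℤ.+ n ⟧    = n ×ₙ 1#
    ⟦ -[1+ n ] ⟧ = - (suc n ×ₙ 1#)

    ⟦-⟧ : ∀ i → ⟦ ℤ.- i ⟧ ≡ - ⟦ i ⟧
    ⟦-⟧ (ℤ.+ zero) = sym -0#≈0#
    ⟦-⟧ +[1+ n ]   = refl
    ⟦-⟧ -[1+ n ]   = sym (-‿involutive _)

    1+x-[1+y]≡x-y : ∀ x y → (1# + x) + - (1# + y) ≡ x + - y
    1+x-[1+y]≡x-y x y = begin
      (1# + x) + - (1# + y)     ≡⟨ cong (λ t → (1# + x) + t) (sym (-‿+-comm 1# y)) ⟩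
      (1# + x) + (- 1# + - y)   ≡⟨ +-interchange 1# x (- 1#) (- y) ⟩
      (1# + - 1#) + (x + - y)   ≡⟨ cong (_+ (x + - y)) (-‿inverseʳ 1#) ⟩
      0# + (x + - y)            ≡⟨ +-identityˡ _ ⟩
      x + - y                   ∎

    ⟦⊖⟧ : ∀ m n → ⟦ m ⊖ n ⟧ ≡ m ×ₙ 1# + - (n ×ₙ 1#)
    ⟦⊖⟧ m zero = begin
      ⟦ m ⊖ 0 ⟧        ≡⟨ cong ⟦_⟧ (ℤ.⊖-≥ {m} ℕ.z≤n) ⟩
      m ×ₙ 1#           ≡⟨ sym (+-identityʳ _) ⟩
      m ×ₙ 1# + 0#      ≡⟨ cong (λ t → m ×ₙ 1# + t) (sym -0#≈0#) ⟩
      m ×ₙ 1# + - 0#    ∎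
    ⟦⊖⟧ zero (suc n) = begin
      ⟦ 0 ⊖ suc n ⟧          ≡⟨ cong ⟦_⟧ (ℤ.⊖-≤ {0} {suc n} ℕ.z≤n) ⟩
      - (suc n ×ₙ 1#)         ≡⟨ sym (+-identityˡ _) ⟩
      0# + - (suc n ×ₙ 1#)    ∎
    ⟦⊖⟧ (suc m) (suc n) = begin
      ⟦ suc m ⊖ suc n ⟧      ≡⟨ cong ⟦_⟧ (ℤ.[1+m]⊖[1+n]≡m⊖n m n) ⟩
      ⟦ m ⊖ n ⟧              ≡⟨ ⟦⊖⟧ m n ⟩
      m ×ₙ 1# + - (n ×ₙ 1#)    ≡⟨ sym (1+x-[1+y]≡x-y _ _) ⟩
      suc m ×ₙ 1# + - (suc n ×ₙ 1#) ∎

    ⟦+⟧ : ∀ i j → ⟦ i ℤ.+ j ⟧ ≡ ⟦ i ⟧ + ⟦ j ⟧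
    ⟦+⟧ (ℤ.+ m)      (ℤ.+ n)      = ×-homo-+ 1# m n
    ⟦+⟧ (ℤ.+ m)      -[1+ n ]   = ⟦⊖⟧ m (suc n)
    ⟦+⟧ -[1+ m ]   (ℤ.+ n)      = trans (⟦⊖⟧ n (suc m)) (+-comm _ _)
    ⟦+⟧ -[1+ m ]   -[1+ n ]   = begin
      - (suc (suc (m ℕ.+ n)) ×ₙ 1#)            ≡⟨ cong (λ k → - (suc k ×ₙ 1#)) (sym (ℕ.+-suc m n)) ⟩
      - ((suc m ℕ.+ suc n) ×ₙ 1#)              ≡⟨ cong -_ (×-homo-+ 1# (suc m) (suc n)) ⟩
      - (suc m ×ₙ 1# + suc n ×ₙ 1#)             ≡⟨ sym (-‿+-comm _ _) ⟩
      - (suc m ×ₙ 1#) + - (suc n ×ₙ 1#)         ∎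

    ⟦_⟧ₛ : Sign → A
    ⟦ Sign.+ ⟧ₛ = 1#
    ⟦ Sign.- ⟧ₛ = - 1#

    ⟦*⟧ₛ : ∀ s t → ⟦ s Sign.* t ⟧ₛ ≡ ⟦ s ⟧ₛ * ⟦ t ⟧ₛ
    ⟦*⟧ₛ Sign.+ t      = sym (*-identityˡ _)
    ⟦*⟧ₛ Sign.- Sign.+ = sym (*-identityʳ _)
    ⟦*⟧ₛ Sign.- Sign.- = begin
      1#               ≡⟨ sym (-‿involutive 1#) ⟩
      - - 1#           ≡⟨ cong -_ (sym (*-identityʳ _)) ⟩
      - (- 1# * 1#)    ≡⟨ -‿distribʳ-* (- 1#) 1# ⟩
      - 1# * - 1#      ∎

    ⟦◃⟧ : ∀ s n → ⟦ s ◃ n ⟧ ≡ ⟦ s ⟧ₛ * (n ×ₙ 1#)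
    ⟦◃⟧ Sign.+ n = trans (cong ⟦_⟧ (ℤ.+◃n≡+n n)) (sym (*-identityˡ _))
    ⟦◃⟧ Sign.- n = begin
      ⟦ Sign.- ◃ n ⟧     ≡⟨ cong ⟦_⟧ (ℤ.-◃n≡-n n) ⟩
      ⟦ ℤ.- (ℤ.+ n) ⟧      ≡⟨ ⟦-⟧ (ℤ.+ n) ⟩
      - (n ×ₙ 1#)         ≡⟨ cong -_ (sym (*-identityˡ _)) ⟩
      - (1# * (n ×ₙ 1#))  ≡⟨ -‿distribˡ-* 1# _ ⟩
      - 1# * (n ×ₙ 1#)    ∎

    ⟦⟧-signAbs : ∀ i → ⟦ i ⟧ ≡ ⟦ sign i ⟧ₛ * (∣ i ∣ ×ₙ 1#)
    ⟦⟧-signAbs i = trans (cong ⟦_⟧ (sym (ℤ.◃-inverse i))) (⟦◃⟧ (sign i) ∣ i ∣)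

    ⟦*⟧ : ∀ i j → ⟦ i ℤ.* j ⟧ ≡ ⟦ i ⟧ * ⟦ j ⟧
    ⟦*⟧ i j = begin
      ⟦ i ℤ.* j ⟧
        ≡⟨ ⟦◃⟧ (sign i Sign.* sign j) (∣ i ∣ ℕ.* ∣ j ∣) ⟩
      ⟦ sign i Sign.* sign j ⟧ₛ * ((∣ i ∣ ℕ.* ∣ j ∣) ×ₙ 1#)
        ≡⟨ cong₂ _*_ (⟦*⟧ₛ (sign i) (sign j)) (×1-homo-* ∣ i ∣ ∣ j ∣) ⟩
      (⟦ sign i ⟧ₛ * ⟦ sign j ⟧ₛ) * ((∣ i ∣ ×ₙ 1#) * (∣ j ∣ ×ₙ 1#))
        ≡⟨ *-interchange _ _ _ _ ⟩
      (⟦ sign i ⟧ₛ * (∣ i ∣ ×ₙ 1#)) * (⟦ sign j ⟧ₛ * (∣ j ∣ ×ₙ 1#))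
        ≡⟨ sym (cong₂ _*_ (⟦⟧-signAbs i) (⟦⟧-signAbs j)) ⟩
      ⟦ i ⟧ * ⟦ j ⟧ ∎

    integerMorphism : ℤ.+-*-rawRing -Raw-AlmostCommutative⟶ fromCommutativeRing commutativeRing
    integerMorphism = record
      { ⟦_⟧    = ⟦_⟧
      ; +-homo = ⟦+⟧
      ; *-homo = ⟦*⟧
      ; -‿homo = ⟦-⟧
      ; 0-homo = refl
      ; 1-homo = +-identityʳ 1#
      }

  open RingSolver ℤ.+-*-rawRing (fromCommutativeRing commutativeRing) integerMorphism
    (λ i j → Maybe.map (cong ⟦_⟧) (dec⇒weaklyDec ℤ._≟_ i j)) public
    using (solve; _:=_; _:+_; _:*_; :-_; _:-_)

cascade : ∀ {A : Set} {k} → (A → A → A) → Vec A k → Vec A k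
cascade σ []       = []
cascade σ (a ∷ as) = a ∷ map (σ a) (cascade σ as)

uncascade : ∀ {A : Set} {k} → (A → A → A) → Vec A k → Vec A k
uncascade τ []       = []
uncascade τ (b ∷ bs) = b ∷ uncascade τ (map (τ b) bs)

map-inverse : ∀ {A : Set} {k} {f g : A → A} → (∀ x → g (f x) ≡ x) → (xs : Vec A k) → map g (map f xs) ≡ xs
map-inverse {f = f} {g} g∘f xs = begin
  map g (map f xs)   ≡⟨ sym (map-∘ g f xs) ⟩
  map (g ∘ f) xs     ≡⟨ map-cong g∘f xs ⟩
  map id xs          ≡⟨ map-id xs ⟩
  xs                 ∎
  where open ≡-Reasoning

module _ {A : Set} {σ τ : A → A → A} where

  uncascade-cascade : (∀ a x → τ a (σ a x) ≡ x) → ∀ {k} (as : Vec A k) → uncascade τ (cascade σ as) ≡ as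
  uncascade-cascade τσ []       = refl
  uncascade-cascade τσ (a ∷ as) =
    cong (a ∷_) (trans (cong (uncascade τ) (map-inverse (τσ a) (cascade σ as))) (uncascade-cascade τσ as))

  cascade-uncascade : (∀ a x → σ a (τ a x) ≡ x) → ∀ {k} (bs : Vec A k) → cascade σ (uncascade τ bs) ≡ bs
  cascade-uncascade στ []       = refl
  cascade-uncascade στ (b ∷ bs) =
    cong (b ∷_) (trans (cong (map (σ b)) (cascade-uncascade στ (map (τ b) bs))) (map-inverse (στ b) bs))

inverses⇒Bijection-Reps : ∀ {X Y : Set} {P : X → Set} {Q : Y → Set} (to : X → Y) (from : Y → X) →
  (∀ x → P x → Q (to x)) → (∀ y → Q y → P (from y)) →
  (∀ x → from (to x) ≡ x) → (∀ y → to (from y) ≡ y) → Bijection-Reps P Q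
inverses⇒Bijection-Reps {X} {Y} {P} {Q} to from to-Q from-P from∘to to∘from = to′ , injective , surjective
  where
  to′ : Σ X P → Σ Y Q
  to′ (x , p) = to x , to-Q x p

  injective : ∀ r s → proj₁ (to′ r) ≡ proj₁ (to′ s) → proj₁ r ≡ proj₁ s
  injective (x , _) (x′ , _) tox≡tox′ = trans (sym (from∘to x)) (trans (cong from tox≡tox′) (from∘to x′))

  surjective : ∀ t → Σ (Σ X P) λ r → proj₁ (to′ r) ≡ proj₁ t
  surjective (y , q) = (from y , from-P y q) , to∘from y

unique∧same-members⇒↭ : ∀ {A : Set} {xs ys : List A} → Unique xs → Unique ys →
  (∀ {x} → x ∈ xs → x ∈ ys) → (∀ {x} → x ∈ ys → x ∈ xs) → xs ↭ ys
unique∧same-members⇒↭ xs! ys! xs⊆ys ys⊆xs = ∼bag⇒↭ (unique∧set⇒bag xs! ys! (mk⇔ xs⊆ys ys⊆xs))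

module _ (F : FiniteField) where
  open FiniteField F
  open IsCommutativeRing isCommutativeRing
    using (+-identityˡ; +-identityʳ; +-comm; *-comm; *-assoc; *-identityˡ; *-identityʳ;
           zeroˡ; zeroʳ; -‿inverseˡ; -‿inverseʳ; *-isCommutativeMonoid)
  open IntegerCoefficients isCommutativeRing

  commutativeRing : CommutativeRing 0ℓ 0ℓ
  commutativeRing = record { isCommutativeRing = isCommutativeRing }

  open GroupProperties (CommutativeRing.+-group commutativeRing)
    using () renaming (∙-cancelˡ to +-cancelˡ; ∙-cancelʳ to +-cancelʳ)
  open ≡-Reasoning

  1≢0 : 1# ≢ 0#
  1≢0 = 0≢1 ∘ sym

  x-y≡0⇒x≡y : ∀ {x y} → x - y ≡ 0# → x ≡ y
  x-y≡0⇒x≡y {x} {y} x-y≡0 = begin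
    x              ≡⟨ solve 2 (λ x y → x := (x :- y) :+ y) refl x y ⟩
    (x - y) + y    ≡⟨ cong (_+ y) x-y≡0 ⟩
    0# + y         ≡⟨ +-identityˡ y ⟩
    y              ∎

  -- The junk value inv 0 = 0 is 0^{q−2}, so that x^{q−2} is inv on all of F_q.
  opaque
    inv : Carrier → Carrier
    inv x with x ≟ 0#
    ... | yes _ = 0#
    ... | no  _ = x ⁻¹

    inv-0 : inv 0# ≡ 0#
    inv-0 with 0# ≟ 0#
    ... | yes _   = refl
    ... | no 0≢0 = ⊥-elim (0≢0 refl)

    *-inverseʳ : ∀ {x} → x ≢ 0# → x * inv x ≡ 1#
    *-inverseʳ {x} x≢0 with x ≟ 0#
    ... | yes x≡0 = ⊥-elim (x≢0 x≡0)
    ... | no  _   = inverseʳ x x≢0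

  x*y≡1⇒x≢0 : ∀ {x y} → x * y ≡ 1# → x ≢ 0#
  x*y≡1⇒x≢0 {x} {y} xy≡1 refl = 0≢1 (trans (sym (zeroˡ y)) xy≡1)

  inv-unique : ∀ {x y} → x * y ≡ 1# → inv x ≡ y
  inv-unique {x} {y} xy≡1 = begin
    inv x              ≡⟨ sym (*-identityʳ _) ⟩
    inv x * 1#         ≡⟨ cong (inv x *_) (sym xy≡1) ⟩
    inv x * (x * y)    ≡⟨ solve 3 (λ x y i → i :* (x :* y) := (x :* i) :* y) refl x y (inv x) ⟩
    (x * inv x) * y    ≡⟨ cong (_* y) (*-inverseʳ (x*y≡1⇒x≢0 xy≡1)) ⟩
    1# * y             ≡⟨ *-identityˡ y ⟩
    y                  ∎

  inv≢0 : ∀ {x} → x ≢ 0# → inv x ≢ 0#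
  inv≢0 {x} x≢0 inv[x]≡0 = 1≢0 (begin
    1#            ≡⟨ sym (*-inverseʳ x≢0) ⟩
    x * inv x     ≡⟨ cong (x *_) inv[x]≡0 ⟩
    x * 0#        ≡⟨ zeroʳ x ⟩
    0#            ∎)

  inv-involutive : ∀ x → inv (inv x) ≡ x
  inv-involutive x with x ≟ 0#
  ... | yes refl = trans (cong inv inv-0) inv-0
  ... | no  x≢0  = inv-unique (trans (*-comm _ x) (*-inverseʳ x≢0))

  inv-* : ∀ x y → inv (x * y) ≡ inv x * inv y
  inv-* x y with x ≟ 0# | y ≟ 0#
  ... | yes refl | _        = trans (cong inv (zeroˡ y)) (trans inv-0 (sym (trans (cong (_* inv y) inv-0) (zeroˡ _))))
  ... | no  _    | yes refl = trans (cong inv (zeroʳ x)) (trans inv-0 (sym (trans (cong (inv x *_) inv-0) (zeroʳ _))))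
  ... | no  x≢0  | no  y≢0  = inv-unique (begin
    (x * y) * (inv x * inv y)    ≡⟨ solve 4 (λ x y i j → (x :* y) :* (i :* j) := (x :* i) :* (y :* j)) refl x y (inv x) (inv y) ⟩
    (x * inv x) * (y * inv y)    ≡⟨ cong₂ _*_ (*-inverseʳ x≢0) (*-inverseʳ y≢0) ⟩
    1# * 1#                      ≡⟨ *-identityʳ 1# ⟩
    1#                           ∎)

  x*y≢0 : ∀ {x y} → x ≢ 0# → y ≢ 0# → x * y ≢ 0#
  x*y≢0 {x} {y} x≢0 y≢0 xy≡0 = y≢0 (begin
    y                  ≡⟨ sym (*-identityˡ y) ⟩
    1# * y             ≡⟨ cong (_* y) (sym (*-inverseʳ x≢0)) ⟩
    (x * inv x) * y    ≡⟨ solve 3 (λ x y i → (x :* i) :* y := i :* (x :* y)) refl x y (inv x) ⟩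
    inv x * (x * y)    ≡⟨ cong (inv x *_) xy≡0 ⟩
    inv x * 0#         ≡⟨ zeroʳ _ ⟩
    0#                 ∎)

  *-cancelʳ : ∀ {x y z} → z ≢ 0# → x * z ≡ y * z → x ≡ y
  *-cancelʳ {x} {y} {z} z≢0 xz≡yz = begin
    x                    ≡⟨ sym (*-identityʳ x) ⟩
    x * 1#               ≡⟨ cong (x *_) (sym (*-inverseʳ z≢0)) ⟩
    x * (z * inv z)      ≡⟨ sym (*-assoc x z _) ⟩
    (x * z) * inv z      ≡⟨ cong (_* inv z) xz≡yz ⟩
    (y * z) * inv z      ≡⟨ *-assoc y z _ ⟩
    y * (z * inv z)      ≡⟨ cong (y *_) (*-inverseʳ z≢0) ⟩
    y * 1#               ≡⟨ *-identityʳ y ⟩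
    y                    ∎

  inv≡⁻¹ : ∀ {x} → x ≢ 0# → inv x ≡ x ⁻¹
  inv≡⁻¹ {x} x≢0 = inv-unique (inverseʳ x x≢0)

  -- Fermat's little theorem

  ≢0? : ∀ x → Dec (x ≢ 0#)
  ≢0? x = ¬? (x ≟ 0#)

  nonzeros : List Carrier
  nonzeros = filter ≢0? elements

  ∈-nonzeros : ∀ {x} → x ≢ 0# → x ∈ nonzeros
  ∈-nonzeros x≢0 = ∈-filter⁺ ≢0? (complete _) x≢0

  nonzeros-≢0 : ∀ {x} → x ∈ nonzeros → x ≢ 0#
  nonzeros-≢0 = proj₂ ∘ ∈-filter⁻ ≢0? {xs = elements}

  nonzeros-unique : Unique nonzeros
  nonzeros-unique = UniqueProperties.filter⁺ ≢0? unique

  size≡1+∣nonzeros∣ : size ≡ suc (length nonzeros)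
  size≡1+∣nonzeros∣ = sym (↭-length (unique∧same-members⇒↭ 0∷nonzeros-unique unique (λ _ → complete _) ∈0∷nonzeros))
    where
    0∷nonzeros-unique : Unique (0# ∷ nonzeros)
    0∷nonzeros-unique = All.tabulate (λ x∈ 0≡x → nonzeros-≢0 x∈ (sym 0≡x)) ∷ nonzeros-unique

    ∈0∷nonzeros : ∀ {x} → x ∈ elements → x ∈ 0# ∷ nonzeros
    ∈0∷nonzeros {x} _ with x ≟ 0#
    ... | yes x≡0 = here x≡0
    ... | no  x≢0 = there (∈-nonzeros x≢0)

  ∏ : List Carrier → Carrier
  ∏ = foldr _*_ 1#

  ∏-↭ : ∀ {xs ys} → xs ↭ ys → ∏ xs ≡ ∏ ys
  ∏-↭ = PermutationSetoid.foldr-commMonoid (setoid Carrier) *-isCommutativeMonoid ∘ ↭⇒↭ₛ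

  ∏-map-* : ∀ c xs → ∏ (List.map (c *_) xs) ≡ pow c (length xs) * ∏ xs
  ∏-map-* c []       = sym (*-identityˡ 1#)
  ∏-map-* c (x ∷ xs) = begin
    (c * x) * ∏ (List.map (c *_) xs)        ≡⟨ cong ((c * x) *_) (∏-map-* c xs) ⟩
    (c * x) * (pow c (length xs) * ∏ xs)    ≡⟨ solve 4 (λ c x p q → (c :* x) :* (p :* q) := (c :* p) :* (x :* q)) refl c x _ _ ⟩
    (c * pow c (length xs)) * (x * ∏ xs)    ∎

  ∏-≢0 : ∀ {xs} → (∀ {x} → x ∈ xs → x ≢ 0#) → ∏ xs ≢ 0#
  ∏-≢0 {[]}     _     = 1≢0
  ∏-≢0 {x ∷ xs} xs≢0 = x*y≢0 (xs≢0 (here refl)) (∏-≢0 (xs≢0 ∘ there))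

  map-*-nonzeros : ∀ {c} → c ≢ 0# → List.map (c *_) nonzeros ↭ nonzeros
  map-*-nonzeros {c} c≢0 = unique∧same-members⇒↭ (UniqueProperties.map⁺ c*-injective nonzeros-unique) nonzeros-unique ⊆ ⊇
    where
    c*-injective : ∀ {x y} → c * x ≡ c * y → x ≡ y
    c*-injective {x} {y} cx≡cy = *-cancelʳ c≢0 (trans (*-comm x c) (trans cx≡cy (*-comm c y)))

    ⊆ : ∀ {y} → y ∈ List.map (c *_) nonzeros → y ∈ nonzeros
    ⊆ y∈ with ∈-map⁻ (c *_) y∈
    ... | x , x∈ , refl = ∈-nonzeros (x*y≢0 c≢0 (nonzeros-≢0 x∈))

    ⊇ : ∀ {y} → y ∈ nonzeros → y ∈ List.map (c *_) nonzeros
    ⊇ {y} y∈ = subst (_∈ List.map (c *_) nonzeros) c*[inv[c]*y]≡y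
      (∈-map⁺ (c *_) (∈-nonzeros (x*y≢0 (inv≢0 c≢0) (nonzeros-≢0 y∈))))
      where
      c*[inv[c]*y]≡y : c * (inv c * y) ≡ y
      c*[inv[c]*y]≡y = trans (sym (*-assoc c _ y)) (trans (cong (_* y) (*-inverseʳ c≢0)) (*-identityˡ y))

  fermat : ∀ {c} → c ≢ 0# → pow c (size ∸ 1) ≡ 1#
  fermat {c} c≢0 = begin
    pow c (size ∸ 1)          ≡⟨ cong (λ n → pow c (n ∸ 1)) size≡1+∣nonzeros∣ ⟩
    pow c (length nonzeros)   ≡⟨ *-cancelʳ (∏-≢0 nonzeros-≢0) c^ℓ*∏≡1*∏ ⟩
    1#                        ∎
    where
    c^ℓ*∏≡1*∏ : pow c (length nonzeros) * ∏ nonzeros ≡ 1# * ∏ nonzeros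
    c^ℓ*∏≡1*∏ = begin
      pow c (length nonzeros) * ∏ nonzeros   ≡⟨ sym (∏-map-* c nonzeros) ⟩
      ∏ (List.map (c *_) nonzeros)           ≡⟨ ∏-↭ (map-*-nonzeros c≢0) ⟩
      ∏ nonzeros                             ≡⟨ sym (*-identityˡ _) ⟩
      1# * ∏ nonzeros                        ∎

  pow[n∸2]≡inv : ∀ n → 2 < n → (∀ {c} → c ≢ 0# → pow c (n ∸ 1) ≡ 1#) → ∀ c → pow c (n ∸ 2) ≡ inv c
  pow[n∸2]≡inv (suc zero)          (s≤s ())
  pow[n∸2]≡inv (suc (suc zero))    (s≤s (s≤s ()))
  pow[n∸2]≡inv (suc (suc (suc m))) _ c^[n∸1]≡1 c with c ≟ 0#
  ... | yes refl = trans (zeroˡ _) (sym inv-0)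
  ... | no  c≢0  = sym (inv-unique (c^[n∸1]≡1 c≢0))

  -- The projective line

  swap∞-hit : ∀ {b c} → c ≡ b → swap∞ F b (just c) ≡ nothing
  swap∞-hit {b} {c} c≡b with c ≟ b
  ... | yes _   = refl
  ... | no  c≢b = ⊥-elim (c≢b c≡b)

  swap∞-miss : ∀ {b c} → c ≢ b → swap∞ F b (just c) ≡ just c
  swap∞-miss {b} {c} c≢b with c ≟ b
  ... | yes c≡b = ⊥-elim (c≢b c≡b)
  ... | no  _   = refl

  module _ {g h : Carrier → Carrier} (h∘g : ∀ x → h (g x) ≡ x) (g∘h : ∀ x → g (h x) ≡ x) where

    swap∞-ext : ∀ b w → swap∞ F b (ext F g w) ≡ ext F g (swap∞ F (h b) w)
    swap∞-ext b nothing  = cong just (sym (g∘h b))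
    swap∞-ext b (just c) with c ≟ h b
    ... | yes refl = swap∞-hit (g∘h b)
    ... | no  c≢hb = swap∞-miss (λ gc≡b → c≢hb (trans (sym (h∘g c)) (cong h gc≡b)))

    chainB-ext : ∀ {k} (bs : Vec Carrier k) w → chainB F bs (ext F g w) ≡ ext F g (chainB F (map h bs) w)
    chainB-ext []       w = refl
    chainB-ext (b ∷ bs) w = trans (cong (swap∞ F b) (chainB-ext bs w)) (swap∞-ext b (chainB F (map h bs) w))

  recip : P1 F → P1 F
  recip nothing  = just 0#
  recip (just x) with x ≟ 0#
  ... | yes _ = nothing
  ... | no  _ = just (inv x)

  recip-hit : ∀ {x} → x ≡ 0# → recip (just x) ≡ nothing
  recip-hit {x} x≡0 with x ≟ 0#
  ... | yes _   = refl
  ... | no  x≢0 = ⊥-elim (x≢0 x≡0)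

  recip-miss : ∀ {x} → x ≢ 0# → recip (just x) ≡ just (inv x)
  recip-miss {x} x≢0 with x ≟ 0#
  ... | yes x≡0 = ⊥-elim (x≢0 x≡0)
  ... | no  _   = refl

  recip-involutive : ∀ w → recip (recip w) ≡ w
  recip-involutive nothing  = recip-hit refl
  recip-involutive (just x) with x ≟ 0#
  ... | yes refl = refl
  ... | no  x≢0  = trans (recip-miss (inv≢0 x≢0)) (cong just (inv-involutive x))

  shift-inverseˡ : ∀ a w → shift F (- a) (shift F a w) ≡ w
  shift-inverseˡ a nothing  = refl
  shift-inverseˡ a (just x) = cong just (solve 2 (λ x a → (x :- a) :- (:- a) := x) refl x a)

  shift-inverseʳ : ∀ a w → shift F a (shift F (- a) w) ≡ w
  shift-inverseʳ a nothing  = refl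
  shift-inverseʳ a (just x) = cong just (solve 2 (λ x a → (x :- (:- a)) :- a := x) refl x a)

  recipShift : Carrier → P1 F → P1 F
  recipShift a = recip ∘ shift F a

  recipShift⁻¹ : Carrier → P1 F → P1 F
  recipShift⁻¹ a = shift F (- a) ∘ recip

  recipShift-inverseˡ : ∀ a w → recipShift⁻¹ a (recipShift a w) ≡ w
  recipShift-inverseˡ a w = trans (cong (shift F (- a)) (recip-involutive (shift F a w))) (shift-inverseˡ a w)

  recipShift-inverseʳ : ∀ a w → recipShift a (recipShift⁻¹ a w) ≡ w
  recipShift-inverseʳ a w = trans (cong recip (shift-inverseʳ a (recip w))) (recip-involutive w)

  recipChain : ∀ {k} → Vec Carrier k → P1 F → P1 F
  recipChain []       = id
  recipChain (a ∷ as) = recipChain as ∘ recipShift a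

  recipChain⁻¹ : ∀ {k} → Vec Carrier k → P1 F → P1 F
  recipChain⁻¹ []       = id
  recipChain⁻¹ (a ∷ as) = recipShift⁻¹ a ∘ recipChain⁻¹ as

  recipChain-inverseˡ : ∀ {k} (as : Vec Carrier k) w → recipChain⁻¹ as (recipChain as w) ≡ w
  recipChain-inverseˡ []       w = refl
  recipChain-inverseˡ (a ∷ as) w =
    trans (cong (recipShift⁻¹ a) (recipChain-inverseˡ as (recipShift a w))) (recipShift-inverseˡ a w)

  recipChain-inverseʳ : ∀ {k} (as : Vec Carrier k) w → recipChain as (recipChain⁻¹ as w) ≡ w
  recipChain-inverseʳ []       w = refl
  recipChain-inverseʳ (a ∷ as) w =
    trans (cong (recipChain as) (recipShift-inverseʳ a (recipChain⁻¹ as w))) (recipChain-inverseʳ as w)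

  invShift : Carrier → Carrier → Carrier
  invShift a c = inv (c - a)

  shiftInv : Carrier → Carrier → Carrier
  shiftInv a c = a + inv c

  shiftInv-invShift : ∀ a c → shiftInv a (invShift a c) ≡ c
  shiftInv-invShift a c = trans (cong (a +_) (inv-involutive (c - a))) (solve 2 (λ a c → a :+ (c :- a) := c) refl a c)

  invShift-shiftInv : ∀ a c → invShift a (shiftInv a c) ≡ c
  invShift-shiftInv a c = trans (cong inv (solve 2 (λ a i → (a :+ i) :- a := i) refl a (inv c))) (inv-involutive c)

  -- (x − a)^{q−2} agrees with 1/(x − a) except at a and ∞, which (a, ∞) exchanges.
  ext-invShift : ∀ a w → ext F (invShift a) w ≡ recipShift a (swap∞ F a w)
  ext-invShift a nothing  = sym (recip-hit (-‿inverseʳ a))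
  ext-invShift a (just c) with c ≟ a
  ... | yes refl = cong just (trans (cong inv (-‿inverseʳ c)) inv-0)
  ... | no  c≢a  = sym (recip-miss (c≢a ∘ x-y≡0⇒x≡y))

  module _ (q>2 : 2 < size) where

    powInv-shift : ∀ a w → powInv F (shift F a w) ≡ ext F (invShift a) w
    powInv-shift a nothing  = refl
    powInv-shift a (just c) = cong just (pow[n∸2]≡inv size q>2 fermat (c - a))

    chainA≡recipChain∘chainB : ∀ {k} (as : Vec Carrier k) z →
      chainA F as z ≡ recipChain as (chainB F (cascade shiftInv as) z)
    chainA≡recipChain∘chainB []       z = refl
    chainA≡recipChain∘chainB {suc k} (a ∷ as) z = begin
      chainA F as (powInv F (shift F a z))
        ≡⟨ chainA≡recipChain∘chainB as _ ⟩
      recipChain as (chainB F bs (powInv F (shift F a z)))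
        ≡⟨ cong (recipChain as ∘ chainB F bs) (powInv-shift a z) ⟩
      recipChain as (chainB F bs (ext F (invShift a) z))
        ≡⟨ cong (recipChain as) (chainB-ext (shiftInv-invShift a) (invShift-shiftInv a) bs z) ⟩
      recipChain as (ext F (invShift a) (chainB F (map (shiftInv a) bs) z))
        ≡⟨ cong (recipChain as) (ext-invShift a _) ⟩
      recipChain (a ∷ as) (chainB F (cascade shiftInv (a ∷ as)) z)
        ∎
      where
      bs : Vec Carrier k
      bs = cascade shiftInv as

  -- Degree-one rational functions

  x*0+y≡y : ∀ x y → x * 0# + y ≡ y
  x*0+y≡y x y = trans (cong (_+ y) (zeroʳ x)) (+-identityˡ y)

  act-frac-pole : ∀ {a b d x} → x + d ≡ 0# → act F (frac a b d) (just x) ≡ nothing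
  act-frac-pole {d = d} {x} x+d≡0 with (x + d) ≟ 0#
  ... | yes _      = refl
  ... | no x+d≢0  = ⊥-elim (x+d≢0 x+d≡0)

  act-frac : ∀ {a b d x} → x + d ≢ 0# → act F (frac a b d) (just x) ≡ just ((a * x + b) * inv (x + d))
  act-frac {a} {b} {d} {x} x+d≢0 with (x + d) ≟ 0#
  ... | yes x+d≡0 = ⊥-elim (x+d≢0 x+d≡0)
  ... | no  _     = cong (λ t → just ((a * x + b) * t)) (sym (inv≡⁻¹ x+d≢0))

  act-frac≡nothing : ∀ {a b d x} → act F (frac a b d) (just x) ≡ nothing → x + d ≡ 0#
  act-frac≡nothing {d = d} {x} ≡nothing with (x + d) ≟ 0#
  ... | yes x+d≡0 = x+d≡0
  ... | no  _ with () ← ≡nothing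

  act-frac-scale : ∀ {a b d x a′ b′ d′ x′} s → s ≢ 0# →
    x + d ≡ s * (x′ + d′) → a * x + b ≡ s * (a′ * x′ + b′) →
    act F (frac a b d) (just x) ≡ act F (frac a′ b′ d′) (just x′)
  act-frac-scale {a} {b} {d} {x} {a′} {b′} {d′} {x′} s s≢0 den num with (x′ + d′) ≟ 0#
  ... | yes u≡0 = act-frac-pole (trans den (trans (cong (s *_) u≡0) (zeroʳ s)))
  ... | no  u≢0 = trans (act-frac (subst (_≢ 0#) (sym den) (x*y≢0 s≢0 u≢0))) (cong just (begin
    (a * x + b) * inv (x + d)              ≡⟨ cong₂ (λ p u → p * inv u) num den ⟩
    (s * p) * inv (s * u)                  ≡⟨ cong ((s * p) *_) (inv-* s u) ⟩
    (s * p) * (inv s * inv u)              ≡⟨ solve 4 (λ s p i j → (s :* p) :* (i :* j) := (s :* i) :* (p :* j)) refl s p (inv s) (inv u) ⟩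
    (s * inv s) * (p * inv u)              ≡⟨ cong (_* (p * inv u)) (*-inverseʳ s≢0) ⟩
    1# * (p * inv u)                       ≡⟨ *-identityˡ _ ⟩
    p * inv u                              ≡⟨ cong (p *_) (inv≡⁻¹ u≢0) ⟩
    p * u ⁻¹                               ∎))
    where
    p u : Carrier
    p = a′ * x′ + b′
    u = x′ + d′

  act-frac-cong : ∀ {a b d x a′ b′ d′ x′} → x + d ≡ x′ + d′ → a * x + b ≡ a′ * x′ + b′ →
    act F (frac a b d) (just x) ≡ act F (frac a′ b′ d′) (just x′)
  act-frac-cong den num = act-frac-scale 1# 1≢0 (trans den (sym (*-identityˡ _))) (trans num (sym (*-identityˡ _)))

  -- Evaluate at ∞, at the pole −d of the left-hand side, and at 1 − d.
  act-injective : ∀ {ν₁ ν₂} → (∀ w → act F ν₁ w ≡ act F ν₂ w) → ν₁ ≡ ν₂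
  act-injective {poly a b} {poly a′ b′} E = cong₂ poly a≡a′ b≡b′
    where
    b≡b′ : b ≡ b′
    b≡b′ = trans (sym (x*0+y≡y a b)) (trans (just-injective (E (just 0#))) (x*0+y≡y a′ b′))
    a≡a′ : a ≡ a′
    a≡a′ = begin
      a          ≡⟨ sym (*-identityʳ a) ⟩
      a * 1#     ≡⟨ +-cancelʳ b _ _ (trans (just-injective (E (just 1#))) (cong (a′ * 1# +_) (sym b≡b′))) ⟩
      a′ * 1#    ≡⟨ *-identityʳ a′ ⟩
      a′         ∎
  act-injective {poly _ _}   {frac _ _ _} E with () ← E nothing
  act-injective {frac _ _ _} {poly _ _}   E with () ← E nothing
  act-injective {frac a b d} {frac a′ b′ d′} E
    with refl ← just-injective (E nothing)
       | refl ← x-y≡0⇒x≡y (trans (+-comm d′ (- d)) (act-frac≡nothing (trans (sym (E (just (- d)))) (act-frac-pole (-‿inverseˡ d)))))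
    = cong (λ b″ → frac a b″ d) (+-cancelˡ (a * x) b b′ (*-cancelʳ (inv≢0 x+d≢0) (just-injective (begin
      just ((a * x + b) * inv (x + d))    ≡⟨ sym (act-frac x+d≢0) ⟩
      act F (frac a b d) (just x)          ≡⟨ E (just x) ⟩
      act F (frac a b′ d) (just x)         ≡⟨ act-frac x+d≢0 ⟩
      just ((a * x + b′) * inv (x + d))   ∎))))
    where
    x : Carrier
    x = 1# - d
    x+d≢0 : x + d ≢ 0#
    x+d≢0 = 1≢0 ∘ trans (solve 2 (λ o d → o := (o :- d) :+ d) refl 1# d)

  record Precomposition (m : P1 F → P1 F) : Set where
    field
      precompose           : Rat1 F → Rat1 F
      act-precompose       : ∀ ν w → act F (precompose ν) w ≡ act F ν (m w)
      precompose-degreeOne : ∀ {ν} → DegreeOne F ν → DegreeOne F (precompose ν)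

  open Precomposition

  id-precomposition : Precomposition id
  id-precomposition = record
    { precompose           = id
    ; act-precompose       = λ _ _ → refl
    ; precompose-degreeOne = id
    }

  ∘-precomposition : ∀ {m m′} → Precomposition m → Precomposition m′ → Precomposition (m ∘ m′)
  ∘-precomposition {m′ = m′} M M′ = record
    { precompose           = precompose M′ ∘ precompose M
    ; act-precompose       = λ ν w → trans (act-precompose M′ (precompose M ν) w) (act-precompose M ν (m′ w))
    ; precompose-degreeOne = precompose-degreeOne M′ ∘ precompose-degreeOne M
    }

  shift-precomposition : ∀ c → Precomposition (shift F c)
  shift-precomposition c = record
    { precompose           = pre
    ; act-precompose       = act-pre
    ; precompose-degreeOne = λ {ν} → pre-degreeOne ν
    }
    where
    pre : Rat1 F → Rat1 F
    pre (poly α β)   = poly α (β - α * c)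
    pre (frac α β d) = frac α (β - α * c) (d - c)

    numerator : ∀ α β x → α * x + (β - α * c) ≡ α * (x - c) + β
    numerator α β x = solve 4 (λ α β c x → α :* x :+ (β :- α :* c) := α :* (x :- c) :+ β) refl α β c x

    act-pre : ∀ ν w → act F (pre ν) w ≡ act F ν (shift F c w)
    act-pre (poly α β)   nothing  = refl
    act-pre (poly α β)   (just x) = cong just (numerator α β x)
    act-pre (frac α β d) nothing  = refl
    act-pre (frac α β d) (just x) =
      act-frac-cong (solve 3 (λ x d c → x :+ (d :- c) := (x :- c) :+ d) refl x d c) (numerator α β x)

    pre-degreeOne : ∀ ν → DegreeOne F ν → DegreeOne F (pre ν)
    pre-degreeOne (poly α β)   α≢0 = α≢0
    pre-degreeOne (frac α β d) Δ≢0 =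
      Δ≢0 ∘ trans (solve 4 (λ α β d c → α :* d :- β := α :* (d :- c) :- (β :- α :* c)) refl α β d c)

  recip-precomposition : Precomposition recip
  recip-precomposition = record
    { precompose           = pre
    ; act-precompose       = act-pre
    ; precompose-degreeOne = λ {ν} → pre-degreeOne ν
    }
    where
    preFrac : ∀ α β d → Dec (d ≡ 0#) → Rat1 F
    preFrac α β d (yes _) = poly β α
    preFrac α β d (no  _) = frac (β * inv d) (α * inv d) (inv d)

    pre : Rat1 F → Rat1 F
    pre (poly α β)   = frac β α 0#
    pre (frac α β d) = preFrac α β d (d ≟ 0#)

    act-pre-poly : ∀ α β w → act F (frac β α 0#) w ≡ act F (poly α β) (recip w)
    act-pre-poly α β nothing  = cong just (sym (x*0+y≡y α β))
    act-pre-poly α β (just x) with x ≟ 0#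
    ... | yes refl = act-frac-pole (+-identityʳ 0#)
    ... | no  x≢0  = trans (act-frac (x≢0 ∘ trans (sym (+-identityʳ x)))) (cong just (begin
      (β * x + α) * inv (x + 0#)          ≡⟨ cong (λ t → (β * x + α) * inv t) (+-identityʳ x) ⟩
      (β * x + α) * inv x                 ≡⟨ solve 4 (λ β x α i → (β :* x :+ α) :* i := α :* i :+ β :* (x :* i)) refl β x α (inv x) ⟩
      α * inv x + β * (x * inv x)         ≡⟨ cong (λ t → α * inv x + β * t) (*-inverseʳ x≢0) ⟩
      α * inv x + β * 1#                  ≡⟨ cong (α * inv x +_) (*-identityʳ β) ⟩
      α * inv x + β                       ∎))

    act-preFrac : ∀ α β d (d≟0 : Dec (d ≡ 0#)) w → act F (preFrac α β d d≟0) w ≡ act F (frac α β d) (recip w)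
    act-preFrac α β d (yes refl) nothing  = sym (act-frac-pole (+-identityʳ 0#))
    act-preFrac α β d (yes refl) (just x) with x ≟ 0#
    ... | yes refl = cong just (x*0+y≡y β α)
    ... | no  x≢0  = sym (trans (act-frac (inv≢0 x≢0 ∘ trans (sym (+-identityʳ _)))) (cong just (begin
      (α * inv x + β) * inv (inv x + 0#)  ≡⟨ cong (λ t → (α * inv x + β) * inv t) (+-identityʳ _) ⟩
      (α * inv x + β) * inv (inv x)       ≡⟨ cong ((α * inv x + β) *_) (inv-involutive x) ⟩
      (α * inv x + β) * x                 ≡⟨ solve 4 (λ α i β x → (α :* i :+ β) :* x := α :* (x :* i) :+ β :* x) refl α (inv x) β x ⟩
      α * (x * inv x) + β * x             ≡⟨ cong (λ t → α * t + β * x) (*-inverseʳ x≢0) ⟩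
      α * 1# + β * x                      ≡⟨ cong (_+ β * x) (*-identityʳ α) ⟩
      α + β * x                           ≡⟨ +-comm α _ ⟩
      β * x + α                           ∎)))
    act-preFrac α β d (no d≢0) nothing = sym (trans (act-frac (d≢0 ∘ trans (sym (+-identityˡ d))))
      (cong just (cong₂ (λ n t → n * inv t) (x*0+y≡y α β) (+-identityˡ d))))
    act-preFrac α β d (no d≢0) (just x) with x ≟ 0#
    ... | yes refl = trans (act-frac (inv≢0 d≢0 ∘ trans (sym (+-identityˡ _)))) (cong just (begin
      ((β * inv d) * 0# + α * inv d) * inv (0# + inv d)  ≡⟨ cong₂ (λ n t → n * inv t) (x*0+y≡y _ _) (+-identityˡ _) ⟩
      (α * inv d) * inv (inv d)                          ≡⟨ cong ((α * inv d) *_) (inv-involutive d) ⟩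
      (α * inv d) * d                                    ≡⟨ solve 3 (λ α i d → (α :* i) :* d := α :* (d :* i)) refl α (inv d) d ⟩
      α * (d * inv d)                                    ≡⟨ cong (α *_) (*-inverseʳ d≢0) ⟩
      α * 1#                                             ≡⟨ *-identityʳ α ⟩
      α                                                  ∎))
    ... | no  x≢0  = act-frac-scale (x * inv d) (x*y≢0 x≢0 (inv≢0 d≢0)) (sym (begin
      (x * i) * (inv x + d)          ≡⟨ solve 4 (λ x i j d → (x :* i) :* (j :+ d) := (x :* j) :* i :+ x :* (d :* i)) refl x i (inv x) d ⟩
      (x * inv x) * i + x * (d * i)  ≡⟨ cong₂ (λ s t → s * i + x * t) (*-inverseʳ x≢0) (*-inverseʳ d≢0) ⟩
      1# * i + x * 1#                ≡⟨ cong₂ _+_ (*-identityˡ i) (*-identityʳ x) ⟩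
      i + x                          ≡⟨ +-comm i x ⟩
      x + i                          ∎)) (sym (begin
      (x * i) * (α * inv x + β)      ≡⟨ solve 5 (λ x i α j β → (x :* i) :* (α :* j :+ β) := α :* (x :* j) :* i :+ (β :* i) :* x) refl x i α (inv x) β ⟩
      α * (x * inv x) * i + (β * i) * x ≡⟨ cong (λ t → α * t * i + (β * i) * x) (*-inverseʳ x≢0) ⟩
      α * 1# * i + (β * i) * x       ≡⟨ cong (λ t → t * i + (β * i) * x) (*-identityʳ α) ⟩
      α * i + (β * i) * x            ≡⟨ +-comm _ _ ⟩
      (β * i) * x + α * i            ∎))
      where
      i : Carrier
      i = inv d

    act-pre : ∀ ν w → act F (pre ν) w ≡ act F ν (recip w)
    act-pre (poly α β)   = act-pre-poly α β
    act-pre (frac α β d) = act-preFrac α β d (d ≟ 0#)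

    preFrac-degreeOne : ∀ α β d (d≟0 : Dec (d ≡ 0#)) → α * d - β ≢ 0# → DegreeOne F (preFrac α β d d≟0)
    preFrac-degreeOne α β d (yes refl) Δ≢0 β≡0 = Δ≢0 (begin
      α * 0# - β     ≡⟨ cong₂ _-_ (zeroʳ α) β≡0 ⟩
      0# - 0#        ≡⟨ -‿inverseʳ 0# ⟩
      0#             ∎)
    preFrac-degreeOne α β d (no  d≢0)  Δ≢0 =
      x*y≢0 (x*y≢0 (inv≢0 d≢0) (inv≢0 d≢0)) β-αd≢0 ∘ trans (begin
        (i * i) * (β - α * d)        ≡⟨ solve 4 (λ α β d i → (i :* i) :* (β :- α :* d) := (β :* i) :* i :- (α :* i) :* (d :* i)) refl α β d i ⟩
        (β * i) * i - (α * i) * (d * i) ≡⟨ cong (λ t → (β * i) * i - (α * i) * t) (*-inverseʳ d≢0) ⟩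
        (β * i) * i - (α * i) * 1#   ≡⟨ cong (λ t → (β * i) * i - t) (*-identityʳ _) ⟩
        (β * i) * i - α * i          ∎)
      where
      i : Carrier
      i = inv d
      β-αd≢0 : β - α * d ≢ 0#
      β-αd≢0 β-αd≡0 = Δ≢0 (begin
        α * d - β      ≡⟨ cong (λ t → α * d - t) (x-y≡0⇒x≡y β-αd≡0) ⟩
        α * d - α * d  ≡⟨ -‿inverseʳ _ ⟩
        0#             ∎)

    pre-degreeOne : ∀ ν → DegreeOne F ν → DegreeOne F (pre ν)
    pre-degreeOne (poly α β)   α≢0 Δ≡0 = α≢0 (trans (sym (x-y≡0⇒x≡y Δ≡0)) (zeroʳ β))
    pre-degreeOne (frac α β d) = preFrac-degreeOne α β d (d ≟ 0#)

  precompose-cancel : ∀ {m m′} (M : Precomposition m) (M′ : Precomposition m′) →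
    (∀ w → m (m′ w) ≡ w) → ∀ μ → precompose M′ (precompose M μ) ≡ μ
  precompose-cancel M M′ m∘m′≗id μ = act-injective λ w →
    trans (act-precompose (∘-precomposition M M′) μ w) (cong (act F μ) (m∘m′≗id w))

  recipChain-precomposition : ∀ {k} (as : Vec Carrier k) → Precomposition (recipChain as)
  recipChain-precomposition []       = id-precomposition
  recipChain-precomposition (a ∷ as) =
    ∘-precomposition (recipChain-precomposition as) (∘-precomposition recip-precomposition (shift-precomposition a))

  recipChain⁻¹-precomposition : ∀ {k} (as : Vec Carrier k) → Precomposition (recipChain⁻¹ as)
  recipChain⁻¹-precomposition []       = id-precomposition
  recipChain⁻¹-precomposition (a ∷ as) =
    ∘-precomposition (∘-precomposition (shift-precomposition (- a)) recip-precomposition) (recipChain⁻¹-precomposition as)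

  -- Representations

  chainA-∞ : ∀ {k} (as : Vec Carrier k) → chainA F as nothing ≡ nothing
  chainA-∞ []       = refl
  chainA-∞ (a ∷ as) = chainA-∞ as

  isRepA⇒isPolynomial : ∀ {f k} μ (as : Vec Carrier k) → IsRepA F f k (μ , as) → IsPolynomial F μ
  isRepA⇒isPolynomial (poly a b)   as _        = tt
  isRepA⇒isPolynomial (frac a b d) as (_ , f≗) with () ← trans (f≗ nothing) (cong (act F (frac a b d)) (chainA-∞ as))

  module Representations (q>2 : 2 < size) (f : Carrier → Carrier) (k : ℕ) where

    toRepB : Rat1 F × Vec Carrier k → Rat1 F × Vec Carrier k
    toRepB (μ , as) = precompose (recipChain-precomposition as) μ , cascade shiftInv as

    toRepA : Rat1 F × Vec Carrier k → Rat1 F × Vec Carrier k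
    toRepA (ν , bs) = precompose (recipChain⁻¹-precomposition (uncascade invShift bs)) ν , uncascade invShift bs

    toRepB-isRepB : ∀ r → IsRepAPoly F f k r → IsRepB F f k (toRepB r)
    toRepB-isRepB (μ , as) (_ , Δ≢0 , f≗) = precompose-degreeOne M Δ≢0 , λ z → begin
      ext F f z                                    ≡⟨ f≗ z ⟩
      act F μ (chainA F as z)                      ≡⟨ cong (act F μ) (chainA≡recipChain∘chainB q>2 as z) ⟩
      act F μ (recipChain as (chainB F bs z))      ≡⟨ act-precompose M μ _ ⟨
      act F (precompose M μ) (chainB F bs z)       ∎
      where
      M : Precomposition (recipChain as)
      M = recipChain-precomposition as

      bs : Vec Carrier k
      bs = cascade shiftInv as

    toRepA-isRepAPoly : ∀ r → IsRepB F f k r → IsRepAPoly F f k (toRepA r)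
    toRepA-isRepAPoly (ν , bs) (Δ≢0 , f≗) = isRepA⇒isPolynomial _ as isRepA , isRepA
      where
      as : Vec Carrier k
      as = uncascade invShift bs

      M⁻¹ : Precomposition (recipChain⁻¹ as)
      M⁻¹ = recipChain⁻¹-precomposition as

      isRepA : IsRepA F f k (toRepA (ν , bs))
      isRepA = precompose-degreeOne M⁻¹ Δ≢0 , λ z → begin
        ext F f z                                     ≡⟨ f≗ z ⟩
        act F ν (chainB F bs z)                       ≡⟨ cong (λ cs → act F ν (chainB F cs z)) (cascade-uncascade shiftInv-invShift bs) ⟨
        act F ν (chainB F (cascade shiftInv as) z)    ≡⟨ cong (act F ν) (recipChain-inverseˡ as _) ⟨
        act F ν (recipChain⁻¹ as (recipChain as (chainB F (cascade shiftInv as) z)))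
                                                      ≡⟨ cong (act F ν ∘ recipChain⁻¹ as) (chainA≡recipChain∘chainB q>2 as z) ⟨
        act F ν (recipChain⁻¹ as (chainA F as z))     ≡⟨ act-precompose M⁻¹ ν _ ⟨
        act F (precompose M⁻¹ ν) (chainA F as z)      ∎

    toRepA∘toRepB : ∀ r → toRepA (toRepB r) ≡ r
    toRepA∘toRepB (μ , as) = cong₂ _,_ (cancel as-roundtrip) as-roundtrip
      where
      as-roundtrip : uncascade invShift (cascade shiftInv as) ≡ as
      as-roundtrip = uncascade-cascade invShift-shiftInv as

      cancel : ∀ {as′} → as′ ≡ as →
        precompose (recipChain⁻¹-precomposition as′) (precompose (recipChain-precomposition as) μ) ≡ μ
      cancel refl = precompose-cancel (recipChain-precomposition as) (recipChain⁻¹-precomposition as) (recipChain-inverseʳ as) μ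

    toRepB∘toRepA : ∀ r → toRepB (toRepA r) ≡ r
    toRepB∘toRepA (ν , bs) = cong₂ _,_
      (precompose-cancel (recipChain⁻¹-precomposition as) (recipChain-precomposition as) (recipChain-inverseˡ as) ν)
      (cascade-uncascade shiftInv-invShift bs)
      where
      as : Vec Carrier k
      as = uncascade invShift bs

corollary4p1 : (F : FiniteField) → 2 < FiniteField.size F → (k : ℕ) → 1 ≤ k →
    (f : FiniteField.Carrier F → FiniteField.Carrier F) → Bijective _≡_ _≡_ f →
    ((μ : Rat1 F) (as : Vec (FiniteField.Carrier F) k) → IsRepA F f k (μ , as) → IsPolynomial F μ)
    × Bijection-Reps (IsRepAPoly F f k) (IsRepB F f k)
corollary4p1 F q>2 k _ f _ =
  isRepA⇒isPolynomial F ,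
  inverses⇒Bijection-Reps toRepB toRepA toRepB-isRepB toRepA-isRepAPoly toRepA∘toRepB toRepB∘toRepA
  where
  open Representations F q>2 f k
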